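{- Let $f$ be the standardly semilinear $n$-ary quasigroup of order $4$ defined by a Boolean function $\lambda:\mathbb{Z}_2^n\to\mathbb{Z}_2$, and let $\{z^1,z^2,z^3,z^4\}$ be a brindled quadruple of Boolean $(n+1)$-vectors. \begin{enumerate} \item If $\lambda(\overline{z^1})\oplus\lambda(\overline{z^2})\oplus\lambda(\overline{z^3})\oplus\lambda(\overline{z^4})=1$, then $f$ has no transversal $\{\alpha^1,\alpha^2,\alpha^3,\alpha^4\}$ with $\{l(\alpha^1),l(\alpha^2),l(\alpha^3),l(\alpha^4)\}=\{z^1,z^2,z^3,z^4\}$. \item If $\lambda(\overline{z^1})\oplus\lambda(\overline{z^2})\oplus\lambda(\overline{z^3})\oplus\lambda(\overline{z^4})=0$, then $f$ has exactly $2\cdot 4^{n-1}$ transversals $\{\alpha^1,\alpha^2,\alpha^3,\alpha^4\}$ with $\{l(\alpha^1),l(\alpha^2),l(\alpha^3),l(\alpha^4)\}=\{z^1,z^2,z^3,z^4\}$. \end{enumerate}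
   Context: Let $\Sigma_4=\{0,1,2,3\}$ and $l:\Sigma_4\to\mathbb{Z}_2$, $l(0)=l(1)=0$, $l(2)=l(3)=1$, applied coordinate-wise to vectors. The standardly semilinear quasigroup defined by $\lambda$ is the map $f:\Sigma_4^n\to\Sigma_4$ such that for all $x_0,\dots,x_n\in\Sigma_4$: $x_0=f(x_1,\dots,x_n)$ iff $l(x_0)+\dots+l(x_n)\equiv0\pmod2$ and $x_0+\dots+x_n+\lambda(l(x_1),\dots,l(x_n))\equiv0\pmod2$ (integer sums). A transversal in $f$ is a set of $4$ vectors $\alpha^i=(a^i_0,\dots,a^i_n)\in\Sigma_4^{n+1}$ with $a^i_0=f(a^i_1,\dots,a^i_n)$ for all $i$ and $a^i_k\ne a^j_k$ for all $i\ne j$ and all $k$. A quadruple is a multiset of four Boolean vectors; a quadruple of $(n+1)$-vectors is proper if in every coordinate its four entries form the multiset $\{0,0,1,1\}$; worthwhile if it is proper and each vector has even weight (even number of ones); brindled if it is worthwhile and its four vectors are pairwise distinct. For $z=(z_0,z_1,\dots,z_n)$ write $\overline{z}=(z_1,\dots,z_n)$; $\oplus$ denotes addition modulo $2$. -}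

module Defs where

open import Data.Bool using (Bool; true; false; _xor_)
open import Data.Nat using (ℕ; zero; suc; _+_; _*_; _∸_; _^_; _%_)
open import Data.Fin using (Fin; toℕ; zero; suc)
open import Data.Fin.Permutation using (Permutation′; _⟨$⟩ʳ_)
open import Data.Vec using (Vec; []; _∷_; lookup; map; head; tail)
open import Data.Product using (Σ; _×_; ∃)
open import Data.List using (List; length)
open import Data.List.Membership.Propositional using (_∈_)
open import Data.List.Relation.Unary.Unique.Propositional using (Unique)
open import Relation.Binary.PropositionalEquality using (_≡_; _≢_)
open import Function.Bundles using (_⇔_)

-- Σ₄ = Fin 4 ; Boolean values = Bool (false = 0, true = 1)

l : Fin 4 → Bool
l zero = false
l (suc zero) = false
l (suc (suc zero)) = true
l (suc (suc (suc zero))) = true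

lv : ∀ {m} → Vec (Fin 4) m → Vec Bool m
lv = map l

b2n : Bool → ℕ
b2n false = 0
b2n true  = 1

weight : ∀ {m} → Vec Bool m → ℕ
weight [] = 0
weight (b ∷ v) = b2n b + weight v

sumΣ : ∀ {m} → Vec (Fin 4) m → ℕ
sumΣ [] = 0
sumΣ (x ∷ v) = toℕ x + sumΣ v

Even : ℕ → Set
Even k = k % 2 ≡ 0

-- The graph of the standardly semilinear n-ary quasigroup defined by λ:
-- x₀ = f(x₁,…,xₙ)  iff  l(x₀)+…+l(xₙ) ≡ 0 (mod 2)
--                   and x₀+…+xₙ+λ(l(x₁),…,l(xₙ)) ≡ 0 (mod 2).
-- The argument is the (n+1)-vector (x₀,x₁,…,xₙ).
IsValue : ∀ {n} → (Vec Bool n → Bool) → Vec (Fin 4) (suc n) → Set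
IsValue λf (x₀ ∷ xs) =
  Even (weight (lv (x₀ ∷ xs))) × Even (sumΣ (x₀ ∷ xs) + b2n (λf (lv xs)))

IsOrdTransversal : ∀ {n} → (Vec Bool n → Bool) → Vec (Vec (Fin 4) (suc n)) 4 → Set
IsOrdTransversal λf α =
  (∀ i → IsValue λf (lookup α i)) ×
  (∀ i j → i ≢ j → ∀ k → lookup (lookup α i) k ≢ lookup (lookup α j) k)

-- multiset equality {l(α¹),…,l(α⁴)} = {z¹,…,z⁴}
LEq : ∀ {n} → Vec (Vec (Fin 4) (suc n)) 4 → Vec (Vec Bool (suc n)) 4 → Set
LEq α z = Σ (Permutation′ 4) λ σ → ∀ i → lv (lookup α i) ≡ lookup z (σ ⟨$⟩ʳ i)

column : ∀ {m} → Vec (Vec Bool m) 4 → Fin m → Vec Bool 4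
column z k = map (λ v → lookup v k) z

Proper : ∀ {m} → Vec (Vec Bool m) 4 → Set
Proper z = ∀ k → weight (column z k) ≡ 2

Worthwhile : ∀ {m} → Vec (Vec Bool m) 4 → Set
Worthwhile z = Proper z × (∀ i → Even (weight (lookup z i)))

Brindled : ∀ {m} → Vec (Vec Bool m) 4 → Set
Brindled z = Worthwhile z × (∀ i j → i ≢ j → lookup z i ≢ lookup z j)

λsum : ∀ {n} → (Vec Bool n → Bool) → Vec (Vec Bool (suc n)) 4 → Bool
λsum λf (z₁ ∷ z₂ ∷ z₃ ∷ z₄ ∷ []) =
  λf (tail z₁) xor λf (tail z₂) xor λf (tail z₃) xor λf (tail z₄)

Good : ∀ {n} → (Vec Bool n → Bool) → Vec (Vec Bool (suc n)) 4 → Vec (Vec (Fin 4) (suc n)) 4 → Set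
Good λf z α = IsOrdTransversal λf α × LEq α z

HasExactly : ∀ {A : Set} → (A → Set) → ℕ → Set
HasExactly {A} P N = ∃ λ (L : List A) → Unique L × (∀ x → (x ∈ L) ⇔ P x) × length L ≡ N

-- Write a letter x of Σ₄ as the pair (l x, x mod 2). A transversal whose l-image is the
-- brindled quadruple z is a reordering (in 24 ways, the rows of z being distinct) of one whose
-- i-th row lifts zⁱ, and such an aligned transversal amounts to choosing, in every coordinate,
-- parity bits that differ on the two rows sharing an l-value, so that row i has parity λ(z̄ⁱ).
-- In a coordinate with l-column d the admissible parity columns form a coset of
-- H(d) = {0000, 1111, d, ¬d}, and every element of it has even weight. Distinct rows force two
-- coordinates with H(d) ≠ H(d′), and then the sums of these cosets cover the 8 even vectors
-- uniformly: the target (λ(z̄¹), …, λ(z̄⁴)) is reached 4ⁿ⁺¹/8 = 2·4ⁿ⁻¹ times if its weight is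
-- even, and never otherwise.

module Submission where

open import Defs
open import Data.Bool using (Bool; true; false; not; _xor_; if_then_else_)
open import Data.Bool.Properties using (not-distribˡ-xor; not-involutive; xor-identityʳ; xor-same)
  renaming (_≟_ to _≟ᵇ_)
open import Data.Empty using (⊥-elim)
open import Data.Fin using (Fin; zero; suc; toℕ; punchOut; _<_)
open import Data.Fin.Permutation using (Permutation′; permutation; flip; _⟨$⟩ʳ_; _⟨$⟩ˡ_; inverseˡ; inverseʳ)
open import Data.Fin.Properties using (all?; any?; pigeonhole; punchOut-injective; <-irrefl)
  renaming (_≟_ to _≟ᶠ_)
open import Data.List using (List; []; _∷_; length; filter; concatMap; cartesianProductWith; allFin)
  renaming (map to mapₗ)
open import Data.List.Properties using (length-++; length-map)
import Data.List.Properties as List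
open import Data.List.Membership.Propositional using (_∈_; find; lose)
open import Data.List.Membership.Propositional.Properties
  using (∈-cartesianProductWith⁺; ∈-filter⁺; ∈-filter⁻; ∈-map⁺; ∈-map⁻; ∈-concatMap⁺; ∈-concatMap⁻
        ; ∈-allFin)
open import Data.List.Relation.Unary.Any using (here; there)
import Data.List.Relation.Unary.All as All
open import Data.List.Relation.Unary.All using ([]; _∷_)
import Data.List.Relation.Unary.All.Properties as All
import Data.List.Relation.Unary.AllPairs as AllPairs
open import Data.List.Relation.Unary.AllPairs using ([]; _∷_)
import Data.List.Relation.Unary.AllPairs.Properties as AllPairs
open import Data.List.Relation.Unary.Unique.Propositional using (Unique)
import Data.List.Relation.Unary.Unique.Propositional.Properties as Unique
open import Data.List.Relation.Binary.Disjoint.Propositional using (Disjoint)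
open import Data.Nat using (ℕ; zero; suc; _+_; _*_; _∸_; _^_; _%_)
open import Data.Nat.ListAction using (sum)
open import Data.Nat.Properties
  using (*-zeroʳ; *-identityʳ; *-assoc; *-comm; *-distribˡ-+; *-cancelʳ-≡; +-comm; n<1+n)
  renaming (_≟_ to _≟ℕ_)
open import Data.Nat.DivMod using ([m+n]%n≡m%n)
open import Data.Nat.Solver using (module +-*-Solver)
open import Data.Product using (∃; ∃₂; _×_; _,_; proj₁; proj₂)
open import Data.Sum using (_⊎_; inj₁; inj₂)
open import Data.Unit using (⊤; tt)
open import Data.Vec using (Vec; []; _∷_; lookup; map; replicate; zipWith; foldr; head; tail; tabulate)
open import Data.Vec.Properties using (≡-dec; ∷-injective; lookup-map; lookup-zipWith; lookup∘tabulate)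
open import Data.Vec.Relation.Binary.Pointwise.Extensional using (ext; Pointwise-≡⇒≡)
open import Function using (_∘_)
open import Function.Bundles using (_⇔_; mk⇔; Equivalence)
open import Relation.Binary.PropositionalEquality
open import Relation.Nullary
  using (Dec; yes; no; does; proof; ofʸ; ¬_; ¬?; _×-dec_; _→-dec_; from-yes; contradiction)
open import Relation.Nullary.Decidable using (map′)
open import Relation.Unary using (Decidable)

private
  variable
    A B : Set
    m r : ℕ

allVecs : List A → ∀ m → List (Vec A m)
allVecs xs zero    = [] ∷ []
allVecs xs (suc m) = cartesianProductWith _∷_ xs (allVecs xs m)

∈-allVecs : {xs : List A} → (∀ x → x ∈ xs) → (v : Vec A m) → v ∈ allVecs xs m
∈-allVecs complete []      = here refl
∈-allVecs complete (x ∷ v) = ∈-cartesianProductWith⁺ _∷_ (complete x) (∈-allVecs complete v)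

allVecs⁺ : {xs : List A} → Unique xs → ∀ m → Unique (allVecs xs m)
allVecs⁺ u zero    = [] ∷ []
allVecs⁺ u (suc m) = Unique.cartesianProductWith⁺ _∷_ ∷-injective u (allVecs⁺ u m)

∀-by-enumeration : {P : A → Set} (xs : List A) → (∀ x → x ∈ xs) → Decidable P → Dec (∀ x → P x)
∀-by-enumeration xs complete P? =
  map′ (λ all x → All.lookup all (complete x)) (λ f → All.tabulate (λ {x} _ → f x)) (All.all? P? xs)

bools : List Bool
bools = false ∷ true ∷ []

∈-bools : ∀ b → b ∈ bools
∈-bools false = here refl
∈-bools true  = there (here refl)

bools⁺ : Unique bools
bools⁺ = ((λ ()) ∷ []) ∷ [] ∷ []

bitVectors : ∀ m → List (Vec Bool m)
bitVectors = allVecs bools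

∀-bitVector? : {P : Vec Bool m → Set} → Decidable P → Dec (∀ v → P v)
∀-bitVector? = ∀-by-enumeration (bitVectors _) (∈-allVecs ∈-bools)

∈⇒length≢0 : {x : A} {xs : List A} → x ∈ xs → length xs ≢ 0
∈⇒length≢0 (here _)  ()
∈⇒length≢0 (there _) ()

length-concatMap : (f : A → List B) (xs : List A) → length (concatMap f xs) ≡ sum (mapₗ (length ∘ f) xs)
length-concatMap f []       = refl
length-concatMap f (x ∷ xs) = trans (length-++ (f x)) (cong (length (f x) +_) (length-concatMap f xs))

sum-map-* : (k : ℕ) (g : A → ℕ) (xs : List A) → sum (mapₗ (λ x → k * g x) xs) ≡ k * sum (mapₗ g xs)
sum-map-* k g []       = sym (*-zeroʳ k)
sum-map-* k g (x ∷ xs) = trans (cong (k * g x +_) (sum-map-* k g xs)) (sym (*-distribˡ-+ k (g x) _))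

sum-map-const : (k : ℕ) (xs : List A) → sum (mapₗ (λ _ → k) xs) ≡ length xs * k
sum-map-const k []       = refl
sum-map-const k (x ∷ xs) = cong (k +_) (sum-map-const k xs)

concatMap⁺ : {f : A → List B} {xs : List A} → Unique xs → (∀ {x} → x ∈ xs → Unique (f x)) →
             (∀ {x y} → x ≢ y → Disjoint (f x) (f y)) → Unique (concatMap f xs)
concatMap⁺ xs! f! disjoint =
  Unique.concat⁺ (All.map⁺ (All.tabulate f!)) (AllPairs.map⁺ (AllPairs.map disjoint xs!))

-- Injective index vectors and permutations

Distinct : Vec A r → Set
Distinct v = ∀ i j → i ≢ j → lookup v i ≢ lookup v j

distinct? : (_≟_ : (x y : A) → Dec (x ≡ y)) (v : Vec A r) → Dec (Distinct v)
distinct? _≟_ v = all? λ i → all? λ j → ¬? (i ≟ᶠ j) →-dec ¬? (lookup v i ≟ lookup v j)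

distinct⇒injective : {v : Vec A r} → Distinct v → ∀ i j → lookup v i ≡ lookup v j → i ≡ j
distinct⇒injective v! i j e with i ≟ᶠ j
... | yes i≡j = i≡j
... | no i≢j  = contradiction e (v! i j i≢j)

injective⇒surjective : ∀ {n} {f : Fin n → Fin n} → (∀ i j → f i ≡ f j → i ≡ j) → ∀ j → ∃ λ i → f i ≡ j
injective⇒surjective {suc n} {f} injective j with any? (λ i → f i ≟ᶠ j)
... | yes hit = hit
-- A missed value j would let f, with j punched out, inject Fin (suc n) into Fin n.
... | no miss = ⊥-elim (noCollision (pigeonhole (n<1+n n) (λ i → punchOut (avoids i))))
  where
  avoids : ∀ i → j ≢ f i
  avoids i j≡fi = miss (i , sym j≡fi)
  noCollision : ¬ ∃₂ λ i i′ → i < i′ × punchOut (avoids i) ≡ punchOut (avoids i′)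
  noCollision (i , i′ , i<i′ , collision) =
    <-irrefl (injective i i′ (punchOut-injective (avoids i) (avoids i′) collision)) i<i′

toPermutation : (p : Vec (Fin r) r) → Distinct p → Permutation′ r
toPermutation {r} p p! =
  permutation (lookup p) preimage (proj₂ ∘ surjective)
              (λ i → injective _ i (proj₂ (surjective (lookup p i))))
  where
  injective : ∀ i j → lookup p i ≡ lookup p j → i ≡ j
  injective = distinct⇒injective {v = p} p!
  surjective : ∀ j → ∃ λ i → lookup p i ≡ j
  surjective = injective⇒surjective injective
  preimage : Fin r → Fin r
  preimage j = proj₁ (surjective j)

-- Parities, letters of Σ₄ and Boolean columns

isOdd : ℕ → Bool
isOdd zero    = false
isOdd (suc k) = not (isOdd k)

isOdd-+ : ∀ m n → isOdd (m + n) ≡ isOdd m xor isOdd n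
isOdd-+ zero    n = refl
isOdd-+ (suc m) n = trans (cong not (isOdd-+ m n)) (not-distribˡ-xor (isOdd m) (isOdd n))

isOdd-b2n : ∀ b → isOdd (b2n b) ≡ b
isOdd-b2n false = refl
isOdd-b2n true  = refl

%2≡b2n∘isOdd : ∀ k → k % 2 ≡ b2n (isOdd k)
%2≡b2n∘isOdd zero          = refl
%2≡b2n∘isOdd (suc zero)    = refl
%2≡b2n∘isOdd (suc (suc k)) = begin
  (suc (suc k)) % 2       ≡⟨ cong (_% 2) (+-comm 2 k) ⟩
  (k + 2) % 2             ≡⟨ [m+n]%n≡m%n k 2 ⟩
  k % 2                   ≡⟨ %2≡b2n∘isOdd k ⟩
  b2n (isOdd k)           ≡⟨ cong b2n (sym (not-involutive (isOdd k))) ⟩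
  b2n (not (not (isOdd k))) ∎
  where open ≡-Reasoning

Even⇔isOdd≡false : ∀ k → Even k ⇔ isOdd k ≡ false
Even⇔isOdd≡false k = mk⇔ (λ e → b2n-injective (trans (sym (%2≡b2n∘isOdd k)) e))
                          (λ o → trans (%2≡b2n∘isOdd k) (cong b2n o))
  where
  b2n-injective : ∀ {b} → b2n b ≡ 0 → b ≡ false
  b2n-injective {false} _ = refl

xor-solve : ∀ a b c → (a xor b ≡ c) ⇔ (b ≡ a xor c)
xor-solve false b c = mk⇔ (λ e → e) (λ e → e)
xor-solve true false false = mk⇔ (λ ()) (λ ())
xor-solve true false true  = mk⇔ (λ _ → refl) (λ _ → refl)
xor-solve true true  false = mk⇔ (λ _ → refl) (λ _ → refl)
xor-solve true true  true  = mk⇔ (λ ()) (λ ())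

parity : Fin 4 → Bool
parity x = isOdd (toℕ x)

letter : Bool → Bool → Fin 4
letter false false = zero
letter false true  = suc zero
letter true  false = suc (suc zero)
letter true  true  = suc (suc (suc zero))

l-letter : ∀ a b → l (letter a b) ≡ a
l-letter false false = refl
l-letter false true  = refl
l-letter true  false = refl
l-letter true  true  = refl

parity-letter : ∀ a b → parity (letter a b) ≡ b
parity-letter false false = refl
parity-letter false true  = refl
parity-letter true  false = refl
parity-letter true  true  = refl

letter-l-parity : ∀ x → letter (l x) (parity x) ≡ x
letter-l-parity zero                   = refl
letter-l-parity (suc zero)             = refl
letter-l-parity (suc (suc zero))       = refl
letter-l-parity (suc (suc (suc zero))) = refl

letter-injective : ∀ {a b a′ b′} → letter a b ≡ letter a′ b′ → a ≡ a′ × b ≡ b′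
letter-injective {a} {b} {a′} {b′} e =
  trans (sym (l-letter a b)) (trans (cong l e) (l-letter a′ b′)) ,
  trans (sym (parity-letter a b)) (trans (cong parity e) (parity-letter a′ b′))

infixr 5 _⊕_

_⊕_ : Vec Bool r → Vec Bool r → Vec Bool r
_⊕_ = zipWith _xor_

⊕-solve : (a b c : Vec Bool r) → (a ⊕ b ≡ c) ⇔ (b ≡ a ⊕ c)
⊕-solve []      []      []      = mk⇔ (λ _ → refl) (λ _ → refl)
⊕-solve (x ∷ a) (y ∷ b) (z ∷ c) = mk⇔
  (λ e → let (e₁ , e₂) = ∷-injective e in cong₂ _∷_ (to (xor-solve x y z) e₁) (to (⊕-solve a b c) e₂))
  (λ e → let (e₁ , e₂) = ∷-injective e in cong₂ _∷_ (from (xor-solve x y z) e₁) (from (⊕-solve a b c) e₂))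
  where open Equivalence

zeros : Vec Bool r
zeros = replicate _ false

_≟ᵛ_ : (u v : Vec Bool r) → Dec (u ≡ v)
_≟ᵛ_ = ≡-dec _≟ᵇ_

Separates : Vec Bool r → Vec Bool r → Set
Separates d p = ∀ i j → i ≢ j → lookup d i ≡ lookup d j → lookup p i ≢ lookup p j

separates? : (d p : Vec Bool r) → Dec (Separates d p)
separates? d p = all? λ i → all? λ j →
  ¬? (i ≟ᶠ j) →-dec ((lookup d i ≟ᵇ lookup d j) →-dec ¬? (lookup p i ≟ᵇ lookup p j))

Respects : Vec Bool r → Vec Bool r → Set
Respects c p = ∀ i j → lookup c i ≡ lookup c j → lookup p i ≡ lookup p j

respects? : (c p : Vec Bool r) → Dec (Respects c p)
respects? c p = all? λ i → all? λ j → (lookup c i ≟ᵇ lookup c j) →-dec (lookup p i ≟ᵇ lookup p j)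

parityChoices : Vec Bool r → List (Vec Bool r)
parityChoices d = filter (separates? d) (bitVectors _)

∈-parityChoices : (d p : Vec Bool r) → p ∈ parityChoices d ⇔ Separates d p
∈-parityChoices d p = mk⇔ (proj₂ ∘ ∈-filter⁻ (separates? d) {xs = bitVectors _})
                          (∈-filter⁺ (separates? d) (∈-allVecs ∈-bools p))

parityChoices⁺ : (d : Vec Bool r) → Unique (parityChoices d)
parityChoices⁺ d = Unique.filter⁺ (separates? d) (allVecs⁺ bools⁺ _)

letters : Vec Bool r → Vec Bool r → Vec (Fin 4) r
letters = zipWith letter

parities : Vec (Fin 4) r → Vec Bool r
parities = map parity

lv-letters : (d p : Vec Bool r) → lv (letters d p) ≡ d
lv-letters []      []      = refl
lv-letters (a ∷ d) (b ∷ p) = cong₂ _∷_ (l-letter a b) (lv-letters d p)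

parities-letters : (d p : Vec Bool r) → parities (letters d p) ≡ p
parities-letters []      []      = refl
parities-letters (a ∷ d) (b ∷ p) = cong₂ _∷_ (parity-letter a b) (parities-letters d p)

letters-lv-parities : (A : Vec (Fin 4) r) → letters (lv A) (parities A) ≡ A
letters-lv-parities []      = refl
letters-lv-parities (x ∷ A) = cong₂ _∷_ (letter-l-parity x) (letters-lv-parities A)

distinct-letters : (d p : Vec Bool r) → Distinct (letters d p) ⇔ Separates d p
distinct-letters d p = mk⇔
  (λ dp! i j i≢j dᵢ≡dⱼ pᵢ≡pⱼ →
     dp! i j i≢j (trans (entry i) (trans (cong₂ letter dᵢ≡dⱼ pᵢ≡pⱼ) (sym (entry j)))))
  (λ sep i j i≢j e →
     let (dᵢ≡dⱼ , pᵢ≡pⱼ) = letter-injective (trans (sym (entry i)) (trans e (entry j)))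
     in sep i j i≢j dᵢ≡dⱼ pᵢ≡pⱼ)
  where
  entry : ∀ i → lookup (letters d p) i ≡ letter (lookup d i) (lookup p i)
  entry i = lookup-zipWith letter i d p

-- Transversals with prescribed l-images and row parities

infixr 5 _∷ᶜ_

_∷ᶜ_ : Vec A r → Vec (Vec A m) r → Vec (Vec A (suc m)) r
_∷ᶜ_ = zipWith _∷_

heads : Vec (Vec A (suc m)) r → Vec A r
heads = map head

tails : Vec (Vec A (suc m)) r → Vec (Vec A m) r
tails = map tail

∷ᶜ-η : (α : Vec (Vec A (suc m)) r) → heads α ∷ᶜ tails α ≡ α
∷ᶜ-η []             = refl
∷ᶜ-η ((x ∷ v) ∷ α) = cong ((x ∷ v) ∷_) (∷ᶜ-η α)

∷ᶜ-injective : {C C′ : Vec A r} {α α′ : Vec (Vec A m) r} → C ∷ᶜ α ≡ C′ ∷ᶜ α′ → C ≡ C′ × α ≡ α′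
∷ᶜ-injective {C = []}    {[]}      {[]}    {[]}      refl = refl , refl
∷ᶜ-injective {C = x ∷ C} {x′ ∷ C′} {v ∷ α} {v′ ∷ α′} e
  with refl , refl ← ∷-injective (proj₁ (∷-injective e))
     | refl , refl ← ∷ᶜ-injective (proj₂ (∷-injective e))
  = refl , refl

lookup-∷ᶜ : (C : Vec A r) (α : Vec (Vec A m) r) (i : Fin r) → lookup (C ∷ᶜ α) i ≡ lookup C i ∷ lookup α i
lookup-∷ᶜ C α i = lookup-zipWith _∷_ i C α

empty-rows : (α β : Vec (Vec A 0) r) → α ≡ β
empty-rows []       []       = refl
empty-rows ([] ∷ α) ([] ∷ β) = cong ([] ∷_) (empty-rows α β)

rowParity : Vec (Fin 4) m → Bool
rowParity v = isOdd (sumΣ v)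

rowParities-[] : (α : Vec (Vec (Fin 4) 0) r) → map rowParity α ≡ zeros
rowParities-[] []       = refl
rowParities-[] ([] ∷ α) = cong (false ∷_) (rowParities-[] α)

rowParities-∷ᶜ : (C : Vec (Fin 4) r) (α : Vec (Vec (Fin 4) m) r) →
                 map rowParity (C ∷ᶜ α) ≡ parities C ⊕ map rowParity α
rowParities-∷ᶜ []      []      = refl
rowParities-∷ᶜ (x ∷ C) (v ∷ α) = cong₂ _∷_ (isOdd-+ (toℕ x) (sumΣ v)) (rowParities-∷ᶜ C α)

lifts-∷ᶜ : (C : Vec (Fin 4) r) (α : Vec (Vec (Fin 4) m) r) → map lv (C ∷ᶜ α) ≡ lv C ∷ᶜ map lv α
lifts-∷ᶜ []      []      = refl
lifts-∷ᶜ (x ∷ C) (v ∷ α) = cong (_ ∷_) (lifts-∷ᶜ C α)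

ColumnsDistinct : Vec (Vec A m) r → Set
ColumnsDistinct α = ∀ i j → i ≢ j → ∀ k → lookup (lookup α i) k ≢ lookup (lookup α j) k

columnsDistinct-∷ᶜ : (C : Vec A r) (α : Vec (Vec A m) r) →
                     ColumnsDistinct (C ∷ᶜ α) ⇔ (Distinct C × ColumnsDistinct α)
columnsDistinct-∷ᶜ C α = mk⇔
  (λ cd → (λ i j i≢j e → cd i j i≢j zero (trans (entry₀ i) (trans e (sym (entry₀ j))))) ,
          (λ i j i≢j k e → cd i j i≢j (suc k) (trans (entryₛ i k) (trans e (sym (entryₛ j k))))))
  (λ { (C! , α!) i j i≢j zero e → C! i j i≢j (trans (sym (entry₀ i)) (trans e (entry₀ j)))
     ; (C! , α!) i j i≢j (suc k) e → α! i j i≢j k (trans (sym (entryₛ i k)) (trans e (entryₛ j k))) })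
  where
  entry₀ : ∀ i → lookup (lookup (C ∷ᶜ α) i) zero ≡ lookup C i
  entry₀ i = cong (λ v → lookup v zero) (lookup-∷ᶜ C α i)
  entryₛ : ∀ i k → lookup (lookup (C ∷ᶜ α) i) (suc k) ≡ lookup (lookup α i) k
  entryₛ i k = cong (λ v → lookup v (suc k)) (lookup-∷ᶜ C α i)

record Aligned (w : Vec (Vec Bool m) r) (t : Vec Bool r) (α : Vec (Vec (Fin 4) m) r) : Set where
  constructor aligned
  field
    lifts           : map lv α ≡ w
    rowParities     : map rowParity α ≡ t
    columnsDistinct : ColumnsDistinct α

aligned-[] : (w : Vec (Vec Bool 0) r) (t : Vec Bool r) (α : Vec (Vec (Fin 4) 0) r) →
             Aligned w t α ⇔ t ≡ zeros
aligned-[] w t α = mk⇔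
  (λ a → trans (sym (Aligned.rowParities a)) (rowParities-[] α))
  (λ t≡0 → aligned (empty-rows _ _) (trans (rowParities-[] α) (sym t≡0)) λ _ _ _ ())

aligned-∷ᶜ : (w : Vec (Vec Bool (suc m)) r) (t : Vec Bool r)
             (C : Vec (Fin 4) r) (α : Vec (Vec (Fin 4) m) r) →
             Aligned w t (C ∷ᶜ α) ⇔ ((lv C ≡ heads w × Distinct C) × Aligned (tails w) (parities C ⊕ t) α)
aligned-∷ᶜ w t C α = mk⇔
  (λ (aligned lifts rowParities cd) →
     let (lvC , lvα) = ∷ᶜ-injective (trans (sym (lifts-∷ᶜ C α)) (trans lifts (sym (∷ᶜ-η w))))
         (C! , α!) = to (columnsDistinct-∷ᶜ C α) cd
     in (lvC , C!) , aligned lvα (to (⊕-solve _ _ t) (trans (sym (rowParities-∷ᶜ C α)) rowParities)) α!)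
  (λ ((lvC , C!) , aligned lvα rowParities α!) →
     aligned (trans (lifts-∷ᶜ C α) (trans (cong₂ _∷ᶜ_ lvC lvα) (∷ᶜ-η w)))
             (trans (rowParities-∷ᶜ C α) (from (⊕-solve _ _ t) rowParities))
             (from (columnsDistinct-∷ᶜ C α) (C! , α!)))
  where open Equivalence

solutions : Vec (Vec Bool m) r → Vec Bool r → List (Vec (Vec (Fin 4) m) r)
solutions {m = zero} w t with t ≟ᵛ zeros
... | yes _ = replicate _ [] ∷ []
... | no _  = []
solutions {m = suc m} w t =
  concatMap (λ p → mapₗ (letters (heads w) p ∷ᶜ_) (solutions (tails w) (p ⊕ t))) (parityChoices (heads w))

∈-solutions : (w : Vec (Vec Bool m) r) (t : Vec Bool r) (α : Vec (Vec (Fin 4) m) r) →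
              α ∈ solutions w t ⇔ Aligned w t α
∈-solutions {m = zero} w t α with t ≟ᵛ zeros
... | yes t≡0 = mk⇔ (λ { (here refl) → from (aligned-[] w t α) t≡0 }) (λ _ → here (empty-rows α _))
  where open Equivalence
... | no t≢0  = mk⇔ (λ ()) (λ a → contradiction (Equivalence.to (aligned-[] w t α) a) t≢0)
∈-solutions {m = suc m} w t α = mk⇔ sound complete
  where
  open Equivalence
  d = heads w
  block : Vec Bool _ → List (Vec (Vec (Fin 4) (suc m)) _)
  block p = mapₗ (letters d p ∷ᶜ_) (solutions (tails w) (p ⊕ t))

  sound : α ∈ solutions w t → Aligned w t α
  sound α∈ with p , p∈ , α∈block ← find (∈-concatMap⁻ block {xs = parityChoices d} α∈)
           with β , β∈ , refl ← ∈-map⁻ (letters d p ∷ᶜ_) α∈block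
    = from (aligned-∷ᶜ w t (letters d p) β)
        ( (lv-letters d p , from (distinct-letters d p) (to (∈-parityChoices d p) p∈))
        , subst (λ q → Aligned (tails w) (q ⊕ t) β) (sym (parities-letters d p))
                (to (∈-solutions _ _ β) β∈))

  complete : Aligned w t α → α ∈ solutions w t
  complete a
    with (lvC , C!) , rest ← to (aligned-∷ᶜ w t (heads α) (tails α)) (subst (Aligned w t) (sym (∷ᶜ-η α)) a)
    = subst (_∈ solutions w t) (∷ᶜ-η α) (∈-concatMap⁺ block (lose p∈ α∈block))
    where
    p = parities (heads α)
    C≡ : letters d p ≡ heads α
    C≡ = trans (cong (λ e → letters e p) (sym lvC)) (letters-lv-parities (heads α))
    p∈ : p ∈ parityChoices d
    p∈ = from (∈-parityChoices d p) (to (distinct-letters d p) (subst Distinct (sym C≡) C!))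
    α∈block : heads α ∷ᶜ tails α ∈ block p
    α∈block = subst (λ C → C ∷ᶜ tails α ∈ block p) C≡ (∈-map⁺ _ (from (∈-solutions _ _ _) rest))

solutions⁺ : (w : Vec (Vec Bool m) r) (t : Vec Bool r) → Unique (solutions w t)
solutions⁺ {m = zero} w t with t ≟ᵛ zeros
... | yes _ = [] ∷ []
... | no _  = []
solutions⁺ {m = suc m} w t =
  concatMap⁺ (parityChoices⁺ d) (λ _ → Unique.map⁺ (proj₂ ∘ ∷ᶜ-injective) (solutions⁺ _ _)) disjoint
  where
  d = heads w
  disjoint : ∀ {p q} → p ≢ q → Disjoint (mapₗ (letters d p ∷ᶜ_) (solutions (tails w) (p ⊕ t)))
                                         (mapₗ (letters d q ∷ᶜ_) (solutions (tails w) (q ⊕ t)))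
  disjoint {p} {q} p≢q (x∈p , x∈q)
    with β , _ , refl ← ∈-map⁻ _ x∈p | γ , _ , e ← ∈-map⁻ _ x∈q
    = p≢q (trans (sym (parities-letters d p))
                 (trans (cong parities (proj₁ (∷ᶜ-injective e))) (parities-letters d q)))

-- Counting solutions column by column

BColumn : Set
BColumn = Vec Bool 4

xorSum : Vec Bool r → Bool
xorSum = foldr _ _xor_ false

-- length (solutions w t) = fibreSize w * [t ∈ supportOf w]. After a run of columns of one class
-- {c, ¬c} the support is the coset P(c) of H(c) that separates the pairs of c (odd run) or H(c)
-- itself (even run); a column of another class makes it the set of all even vectors.
data Support : Set where
  origin     : Support
  separating : BColumn → Support
  respecting : BColumn → Support
  evenWeight : Support

InSupport : Support → BColumn → Set
InSupport origin         t = t ≡ zeros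
InSupport (separating c) t = Separates c t
InSupport (respecting c) t = Respects c t
InSupport evenWeight     t = xorSum t ≡ false

inSupport? : ∀ s t → Dec (InSupport s t)
inSupport? origin         t = t ≟ᵛ zeros
inSupport? (separating c) t = separates? c t
inSupport? (respecting c) t = respects? c t
inSupport? evenWeight     t = xorSum t ≟ᵇ false

indicator : Support → BColumn → ℕ
indicator s t = b2n (does (inSupport? s t))

size : Support → ℕ
size origin         = 1
size (separating _) = 4
size (respecting _) = 4
size evenWeight     = 8

WellFormed : Support → Set
WellFormed (separating c) = weight c ≡ 2
WellFormed (respecting c) = weight c ≡ 2
WellFormed _              = ⊤

extend : BColumn → Support → Support
extend d origin         = separating d
extend d (separating c) = if does (respects? c d) then respecting c else evenWeight
extend d (respecting c) = if does (respects? c d) then separating c else evenWeight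
extend d evenWeight     = evenWeight

growth : BColumn → Support → ℕ
growth d origin         = 1
growth d (separating c) = if does (respects? c d) then 4 else 2
growth d (respecting c) = if does (respects? c d) then 4 else 2
growth d evenWeight     = 4

Counts : BColumn → Support → Set
Counts d s = ∀ t →
  sum (mapₗ (λ p → indicator s (p ⊕ t)) (parityChoices d)) ≡ growth d s * indicator (extend d s) t

counts? : ∀ d s → Dec (Counts d s)
counts? d s = ∀-bitVector? λ t →
  sum (mapₗ (λ p → indicator s (p ⊕ t)) (parityChoices d)) ≟ℕ growth d s * indicator (extend d s) t

counts-classes : ∀ d → weight d ≡ 2 → ∀ c → weight c ≡ 2 → Counts d (separating c) × Counts d (respecting c)
counts-classes = from-yes (∀-bitVector? λ d → (weight d ≟ℕ 2) →-dec ∀-bitVector? λ c → (weight c ≟ℕ 2) →-dec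
                             (counts? d (separating c) ×-dec counts? d (respecting c)))

counts-origin-evenWeight : ∀ d → weight d ≡ 2 → Counts d origin × Counts d evenWeight
counts-origin-evenWeight = from-yes (∀-bitVector? λ d → (weight d ≟ℕ 2) →-dec
                                       (counts? d origin ×-dec counts? d evenWeight))

counts : ∀ d → weight d ≡ 2 → ∀ s → WellFormed s → Counts d s
counts d d₂ origin         _  = proj₁ (counts-origin-evenWeight d d₂)
counts d d₂ (separating c) c₂ = proj₁ (counts-classes d d₂ c c₂)
counts d d₂ (respecting c) c₂ = proj₂ (counts-classes d d₂ c c₂)
counts d d₂ evenWeight     _  = proj₂ (counts-origin-evenWeight d d₂)

extend-wellFormed : ∀ d → weight d ≡ 2 → ∀ s → WellFormed s → WellFormed (extend d s)
extend-wellFormed d d₂ origin _ = d₂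
extend-wellFormed d d₂ (separating c) c₂ with does (respects? c d)
... | true  = c₂
... | false = tt
extend-wellFormed d d₂ (respecting c) c₂ with does (respects? c d)
... | true  = c₂
... | false = tt
extend-wellFormed d d₂ evenWeight _ = tt

growth-size : ∀ d s → growth d s * size (extend d s) ≡ 4 * size s
growth-size d origin = refl
growth-size d (separating c) with does (respects? c d)
... | true  = refl
... | false = refl
growth-size d (respecting c) with does (respects? c d)
... | true  = refl
... | false = refl
growth-size d evenWeight = refl

supportOf : Vec (Vec Bool m) 4 → Support
supportOf {m = zero}  w = origin
supportOf {m = suc m} w = extend (heads w) (supportOf (tails w))

fibreSize : Vec (Vec Bool m) 4 → ℕ
fibreSize {m = zero}  w = 1
fibreSize {m = suc m} w = fibreSize (tails w) * growth (heads w) (supportOf (tails w))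

column-heads : (w : Vec (Vec Bool (suc m)) 4) → column w zero ≡ heads w
column-heads ((_ ∷ _) ∷ (_ ∷ _) ∷ (_ ∷ _) ∷ (_ ∷ _) ∷ []) = refl

column-tails : (w : Vec (Vec Bool (suc m)) 4) (k : Fin m) → column (tails w) k ≡ column w (suc k)
column-tails ((_ ∷ _) ∷ (_ ∷ _) ∷ (_ ∷ _) ∷ (_ ∷ _) ∷ []) k = refl

proper-heads : (w : Vec (Vec Bool (suc m)) 4) → Proper w → weight (heads w) ≡ 2
proper-heads w w₂ = trans (cong weight (sym (column-heads w))) (w₂ zero)

proper-tails : (w : Vec (Vec Bool (suc m)) 4) → Proper w → Proper (tails w)
proper-tails w w₂ k = trans (cong weight (column-tails w k)) (w₂ (suc k))

supportOf-wellFormed : (w : Vec (Vec Bool m) 4) → Proper w → WellFormed (supportOf w)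
supportOf-wellFormed {m = zero}  w w₂ = tt
supportOf-wellFormed {m = suc m} w w₂ =
  extend-wellFormed (heads w) (proper-heads w w₂) _ (supportOf-wellFormed (tails w) (proper-tails w w₂))

length-solutions : (w : Vec (Vec Bool m) 4) → Proper w → ∀ t →
                   length (solutions w t) ≡ fibreSize w * indicator (supportOf w) t
length-solutions {m = zero} w w₂ t with t ≟ᵛ zeros
... | yes _ = refl
... | no _  = refl
length-solutions {m = suc m} w w₂ t = begin
  length (solutions w t)
    ≡⟨ length-concatMap block (parityChoices d) ⟩
  sum (mapₗ (length ∘ block) (parityChoices d))
    ≡⟨ cong sum (List.map-cong length-block (parityChoices d)) ⟩
  sum (mapₗ (λ p → K * indicator s (p ⊕ t)) (parityChoices d))
    ≡⟨ sum-map-* K (λ p → indicator s (p ⊕ t)) (parityChoices d) ⟩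
  K * sum (mapₗ (λ p → indicator s (p ⊕ t)) (parityChoices d))
    ≡⟨ cong (K *_) (counts d (proper-heads w w₂) s (supportOf-wellFormed (tails w) (proper-tails w w₂)) t) ⟩
  K * (growth d s * indicator (extend d s) t)
    ≡⟨ sym (*-assoc K (growth d s) _) ⟩
  K * growth d s * indicator (extend d s) t ∎
  where
  open ≡-Reasoning
  d = heads w
  s = supportOf (tails w)
  K = fibreSize (tails w)
  block : BColumn → List (Vec (Vec (Fin 4) (suc m)) 4)
  block p = mapₗ (letters d p ∷ᶜ_) (solutions (tails w) (p ⊕ t))
  length-block : ∀ p → length (block p) ≡ K * indicator s (p ⊕ t)
  length-block p = trans (length-map _ (solutions (tails w) (p ⊕ t)))
                         (length-solutions (tails w) (proper-tails w w₂) (p ⊕ t))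

fibreSize-size : (w : Vec (Vec Bool m) 4) → fibreSize w * size (supportOf w) ≡ 4 ^ m
fibreSize-size {m = zero}  w = refl
fibreSize-size {m = suc m} w = begin
  K * growth d s * size (extend d s) ≡⟨ *-assoc K (growth d s) _ ⟩
  K * (growth d s * size (extend d s)) ≡⟨ cong (K *_) (growth-size d s) ⟩
  K * (4 * size s)                     ≡⟨ *-comm K (4 * size s) ⟩
  4 * size s * K                       ≡⟨ *-assoc 4 (size s) K ⟩
  4 * (size s * K)                     ≡⟨ cong (4 *_) (*-comm (size s) K) ⟩
  4 * (K * size s)                     ≡⟨ cong (4 *_) (fibreSize-size (tails w)) ⟩
  4 * 4 ^ m                            ∎
  where
  open ≡-Reasoning
  d = heads w
  s = supportOf (tails w)
  K = fibreSize (tails w)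

IsClass : BColumn → Support → Set
IsClass c s = s ≡ separating c ⊎ s ≡ respecting c

extend≢origin : ∀ d s → extend d s ≢ origin
extend≢origin d origin         ()
extend≢origin d (separating c) with does (respects? c d)
... | true  = λ ()
... | false = λ ()
extend≢origin d (respecting c) with does (respects? c d)
... | true  = λ ()
... | false = λ ()
extend≢origin d evenWeight     ()

supportOf≢origin : (w : Vec (Vec Bool m) 4) → Fin m → supportOf w ≢ origin
supportOf≢origin {m = suc m} w _ = extend≢origin (heads w) (supportOf (tails w))

extend-class : ∀ {c} d s → IsClass c (extend d s) → Respects c d × (s ≡ origin ⊎ IsClass c s)
extend-class d origin (inj₁ refl) = (λ i j e → e) , inj₁ refl
extend-class d (separating c) with does (respects? c d) | proof (respects? c d)
... | true  | ofʸ c∼d = λ { (inj₂ refl) → c∼d , inj₂ (inj₁ refl) }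
... | false | _       = λ { (inj₁ ()) ; (inj₂ ()) }
extend-class d (respecting c) with does (respects? c d) | proof (respects? c d)
... | true  | ofʸ c∼d = λ { (inj₁ refl) → c∼d , inj₂ (inj₂ refl) }
... | false | _       = λ { (inj₁ ()) ; (inj₂ ()) }
extend-class d evenWeight (inj₁ ())
extend-class d evenWeight (inj₂ ())

classColumns : ∀ {c} (w : Vec (Vec Bool m) 4) → IsClass c (supportOf w) → ∀ k → Respects c (column w k)
classColumns {m = suc m} {c} w cls k with extend-class (heads w) (supportOf (tails w)) cls | k
... | c∼d , _              | zero  = subst (Respects c) (sym (column-heads w)) c∼d
... | _   , inj₁ s≡origin  | suc k = ⊥-elim (supportOf≢origin (tails w) k s≡origin)
... | _   , inj₂ cls′      | suc k = subst (Respects c) (column-tails w k) (classColumns (tails w) cls′ k)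

partner : ∀ c → weight c ≡ 2 → ∃ λ j → j ≢ zero × lookup c zero ≡ lookup c j
partner = from-yes (∀-bitVector? λ c → (weight c ≟ℕ 2) →-dec
                     any? {n = 4} λ j → ¬? (j ≟ᶠ zero) ×-dec (lookup c zero ≟ᵇ lookup c j))

rows-agree : (w : Vec (Vec Bool m) 4) (i j : Fin 4) →
             (∀ k → lookup (column w k) i ≡ lookup (column w k) j) → lookup w i ≡ lookup w j
rows-agree w i j agree =
  Pointwise-≡⇒≡ (ext λ k → trans (sym (lookup-map i _ w)) (trans (agree k) (lookup-map j _ w)))

class⇒¬distinctRows : ∀ {c} (w : Vec (Vec Bool m) 4) → weight c ≡ 2 → IsClass c (supportOf w) → ¬ Distinct w
class⇒¬distinctRows {c = c} w c₂ cls w! with j , j≢0 , c₀≡cⱼ ← partner c c₂ =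
  w! zero j (j≢0 ∘ sym) (rows-agree w zero j (λ k → classColumns w cls k zero j c₀≡cⱼ))

distinctRows⇒evenWeight : (w : Vec (Vec Bool (suc m)) 4) → Proper w → Distinct w → supportOf w ≡ evenWeight
distinctRows⇒evenWeight w w₂ w! with supportOf w in e | supportOf-wellFormed w w₂
... | origin       | _  = ⊥-elim (supportOf≢origin w zero e)
... | separating c | c₂ = ⊥-elim (class⇒¬distinctRows w c₂ (inj₁ e) w!)
... | respecting c | c₂ = ⊥-elim (class⇒¬distinctRows w c₂ (inj₂ e) w!)
... | evenWeight   | _  = refl

-- Transversals of f with l-image the rows of z

even-+-b2n : ∀ s b → Even (s + b2n b) ⇔ isOdd s ≡ b
even-+-b2n s b = mk⇔
  (λ ev → let b≡odd⊕0 = to (xor-solve (isOdd s) b false) (trans (sym oddness) (to (Even⇔isOdd≡false (s + b2n b)) ev))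
          in sym (trans b≡odd⊕0 (xor-identityʳ (isOdd s))))
  (λ e → from (Even⇔isOdd≡false (s + b2n b)) (trans oddness (trans (cong (_xor b) e) (xor-same b))))
  where
  open Equivalence
  oddness : isOdd (s + b2n b) ≡ isOdd s xor b
  oddness = trans (isOdd-+ s (b2n b)) (cong (isOdd s xor_) (isOdd-b2n b))

isValue⇔ : ∀ {n} (λf : Vec Bool n → Bool) (v : Vec (Fin 4) (suc n)) → Even (weight (lv v)) →
           IsValue λf v ⇔ rowParity v ≡ λf (tail (lv v))
isValue⇔ λf (x ∷ xs) ev = mk⇔ (to parity⇔ ∘ proj₂) (λ e → ev , from parity⇔ e)
  where
  open Equivalence
  parity⇔ = even-+-b2n (sumΣ (x ∷ xs)) (λf (lv xs))

map-≡⇔ : (f : A → B) (α : Vec A r) (w : Vec B r) → map f α ≡ w ⇔ (∀ i → f (lookup α i) ≡ lookup w i)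
map-≡⇔ f α w = mk⇔ (λ e i → trans (sym (lookup-map i f α)) (cong (λ v → lookup v i) e))
                   (λ h → Pointwise-≡⇒≡ (ext λ i → trans (lookup-map i f α) (h i)))

reorder : Vec (Fin r) r → Vec A r → Vec A r
reorder p α = map (lookup α) p

lookup-reorder : (p : Vec (Fin r) r) (α : Vec A r) (i : Fin r) →
                 lookup (reorder p α) i ≡ lookup α (lookup p i)
lookup-reorder p α i = lookup-map i (lookup α) p

reorder-injective : {p : Vec (Fin r) r} → Distinct p → {α β : Vec A r} → reorder p α ≡ reorder p β → α ≡ β
reorder-injective {p = p} p! {α} {β} e = Pointwise-≡⇒≡ (ext pointwise)
  where
  open ≡-Reasoning
  σ = toPermutation p p!
  pointwise : ∀ j → lookup α j ≡ lookup β j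
  pointwise j = begin
    lookup α j                   ≡⟨ cong (lookup α) (sym (inverseʳ σ)) ⟩
    lookup α (lookup p i)        ≡⟨ sym (lookup-reorder p α i) ⟩
    lookup (reorder p α) i       ≡⟨ cong (λ v → lookup v i) e ⟩
    lookup (reorder p β) i       ≡⟨ lookup-reorder p β i ⟩
    lookup β (lookup p i)        ≡⟨ cong (lookup β) (inverseʳ σ) ⟩
    lookup β j                   ∎
    where i = σ ⟨$⟩ˡ j

columnsDistinct-reorder : {p : Vec (Fin r) r} → Distinct p → {α : Vec (Vec A m) r} → ColumnsDistinct α →
                          ColumnsDistinct (reorder p α)
columnsDistinct-reorder {p = p} p! {α} α! i j i≢j k e =
  α! (lookup p i) (lookup p j) (p! i j i≢j) k (trans (sym (entry i)) (trans e (entry j)))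
  where
  entry : ∀ i → lookup (lookup (reorder p α) i) k ≡ lookup (lookup α (lookup p i)) k
  entry i = cong (λ v → lookup v k) (lookup-reorder p α i)

permutation-distinct : (σ : Permutation′ r) → Distinct (tabulate (σ ⟨$⟩ʳ_))
permutation-distinct σ i j i≢j e = i≢j (begin
  i                       ≡⟨ inverseˡ σ ⟨
  σ ⟨$⟩ˡ (σ ⟨$⟩ʳ i)       ≡⟨ cong (σ ⟨$⟩ˡ_) σᵢ≡σⱼ ⟩
  σ ⟨$⟩ˡ (σ ⟨$⟩ʳ j)       ≡⟨ inverseˡ σ ⟩
  j                       ∎)
  where
  open ≡-Reasoning
  σᵢ≡σⱼ : σ ⟨$⟩ʳ i ≡ σ ⟨$⟩ʳ j
  σᵢ≡σⱼ = trans (sym (lookup∘tabulate _ i)) (trans e (lookup∘tabulate _ j))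

reorderings : List (Vec (Fin 4) 4)
reorderings = filter (distinct? _≟ᶠ_) (allVecs (allFin 4) 4)

∈-reorderings : (p : Vec (Fin 4) 4) → p ∈ reorderings ⇔ Distinct p
∈-reorderings p = mk⇔ (proj₂ ∘ ∈-filter⁻ (distinct? _≟ᶠ_) {xs = allVecs (allFin 4) 4})
                      (∈-filter⁺ (distinct? _≟ᶠ_) (∈-allVecs ∈-allFin p))

reorderings⁺ : Unique reorderings
reorderings⁺ = Unique.filter⁺ (distinct? _≟ᶠ_) (allVecs⁺ (Unique.allFin⁺ 4) 4)

xorSum-targets : ∀ {n} (λf : Vec Bool n → Bool) (z : Vec (Vec Bool (suc n)) 4) →
                 xorSum (map (λf ∘ tail) z) ≡ λsum λf z
xorSum-targets λf (z₁ ∷ z₂ ∷ z₃ ∷ z₄ ∷ []) =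
  cong (λ b → λf (tail z₁) xor λf (tail z₂) xor λf (tail z₃) xor b) (xor-identityʳ (λf (tail z₄)))

module _ {n} (λf : Vec Bool n → Bool) (z : Vec (Vec Bool (suc n)) 4) where

  targets : Vec Bool 4
  targets = map (λf ∘ tail) z

  reorderedSolutions : Vec (Fin 4) 4 → List (Vec (Vec (Fin 4) (suc n)) 4)
  reorderedSolutions p = mapₗ (reorder p) (solutions z targets)

  transversals : List (Vec (Vec (Fin 4) (suc n)) 4)
  transversals = concatMap reorderedSolutions reorderings

  aligned⇒isValue : (∀ i → Even (weight (lookup z i))) → ∀ {α} → Aligned z targets α →
                    ∀ j → IsValue λf (lookup α j)
  aligned⇒isValue z-even {α} (aligned lifts rowParities _) j =
    from (isValue⇔ λf (lookup α j) (subst (Even ∘ weight) (sym (lvⱼ)) (z-even j)))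
         (trans (to (map-≡⇔ rowParity α targets) rowParities j)
                (trans (lookup-map j (λf ∘ tail) z) (cong (λf ∘ tail) (sym lvⱼ))))
    where
    open Equivalence
    lvⱼ : lv (lookup α j) ≡ lookup z j
    lvⱼ = to (map-≡⇔ lv α z) lifts j

  reordered⇒good : (∀ i → Even (weight (lookup z i))) → ∀ {p α} → p ∈ reorderings → α ∈ solutions z targets →
                   Good λf z (reorder p α)
  reordered⇒good z-even {p} {α} p∈ α∈ =
    ( (λ i → subst (IsValue λf) (sym (lookup-reorder p α i)) (aligned⇒isValue z-even a (lookup p i)))
    , columnsDistinct-reorder {p = p} p! {α} (Aligned.columnsDistinct a))
    , toPermutation p p!
    , λ i → trans (cong lv (lookup-reorder p α i)) (to (map-≡⇔ lv α z) (Aligned.lifts a) (lookup p i))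
    where
    open Equivalence
    p! = to (∈-reorderings p) p∈
    a = to (∈-solutions z targets α) α∈

  ∈transversals⇒good : (∀ i → Even (weight (lookup z i))) → ∀ x → x ∈ transversals → Good λf z x
  ∈transversals⇒good z-even x x∈ =
    let p , p∈ , x∈block = find (∈-concatMap⁻ reorderedSolutions {xs = reorderings} x∈)
        α , α∈ , x≡ = ∈-map⁻ (reorder p) x∈block
    in subst (Good λf z) (sym x≡) (reordered⇒good z-even p∈ α∈)

  good⇒∈transversals : (∀ i → Even (weight (lookup z i))) → ∀ x → Good λf z x → x ∈ transversals
  good⇒∈transversals z-even x ((values , x!) , σ , lvσ) =
    ∈-concatMap⁺ reorderedSolutions
      (lose (from (∈-reorderings p) (permutation-distinct σ))
            (subst (_∈ reorderedSolutions p) x≡ (∈-map⁺ (reorder p) (from (∈-solutions z targets α) α-aligned))))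
    where
    open Equivalence
    open ≡-Reasoning
    p q : Vec (Fin 4) 4
    p = tabulate (σ ⟨$⟩ʳ_)
    q = tabulate (σ ⟨$⟩ˡ_)
    α = reorder q x
    αⱼ : ∀ j → lookup α j ≡ lookup x (σ ⟨$⟩ˡ j)
    αⱼ j = trans (lookup-reorder q x j) (cong (lookup x) (lookup∘tabulate (σ ⟨$⟩ˡ_) j))
    x≡ : reorder p α ≡ x
    x≡ = Pointwise-≡⇒≡ (ext λ i → begin
      lookup (reorder p α) i           ≡⟨ lookup-reorder p α i ⟩
      lookup α (lookup p i)            ≡⟨ cong (lookup α) (lookup∘tabulate (σ ⟨$⟩ʳ_) i) ⟩
      lookup α (σ ⟨$⟩ʳ i)              ≡⟨ αⱼ (σ ⟨$⟩ʳ i) ⟩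
      lookup x (σ ⟨$⟩ˡ (σ ⟨$⟩ʳ i))     ≡⟨ cong (lookup x) (inverseˡ σ) ⟩
      lookup x i                       ∎)
    lvⱼ : ∀ j → lv (lookup α j) ≡ lookup z j
    lvⱼ j = trans (cong lv (αⱼ j)) (trans (lvσ (σ ⟨$⟩ˡ j)) (cong (lookup z) (inverseʳ σ)))
    α-aligned : Aligned z targets α
    α-aligned = aligned
      (from (map-≡⇔ lv α z) lvⱼ)
      (from (map-≡⇔ rowParity α targets) λ j →
        trans (cong rowParity (αⱼ j))
          (trans (to (isValue⇔ λf _ (subst (Even ∘ weight) (sym (lvσ _)) (z-even _))) (values (σ ⟨$⟩ˡ j)))
            (trans (cong (λf ∘ tail) (trans (sym (cong lv (αⱼ j))) (lvⱼ j))) (sym (lookup-map j (λf ∘ tail) z)))))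
      (columnsDistinct-reorder {p = q} (permutation-distinct (flip σ)) {x} x!)

  transversals⁺ : Distinct z → Unique transversals
  transversals⁺ z! = concatMap⁺ {f = reorderedSolutions} reorderings⁺
    (λ p∈ → Unique.map⁺ (reorder-injective (Equivalence.to (∈-reorderings _) p∈)) (solutions⁺ z targets))
    disjoint
    where
    lvᵢ : ∀ {α} → α ∈ solutions z targets → ∀ i → lv (lookup α i) ≡ lookup z i
    lvᵢ {α} α∈ = Equivalence.to (map-≡⇔ lv α z) (Aligned.lifts (Equivalence.to (∈-solutions z targets α) α∈))
    disjoint : ∀ {p q} → p ≢ q → Disjoint (reorderedSolutions p) (reorderedSolutions q)
    disjoint {p} {q} p≢q {y} (y∈p , y∈q) =
      let α , α∈ , y≡p = ∈-map⁻ (reorder p) y∈p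
          β , β∈ , y≡q = ∈-map⁻ (reorder q) y∈q
          pᵢ≡qᵢ : ∀ i → lookup p i ≡ lookup q i
          pᵢ≡qᵢ i = distinct⇒injective {v = z} z! (lookup p i) (lookup q i) (begin
            lookup z (lookup p i)       ≡⟨ lvᵢ α∈ (lookup p i) ⟨
            lv (lookup α (lookup p i))  ≡⟨ cong lv (lookup-reorder p α i) ⟨
            lv (lookup (reorder p α) i) ≡⟨ cong (λ v → lv (lookup v i)) (trans (sym y≡p) y≡q) ⟩
            lv (lookup (reorder q β) i) ≡⟨ cong lv (lookup-reorder q β i) ⟩
            lv (lookup β (lookup q i))  ≡⟨ lvᵢ β∈ (lookup q i) ⟩
            lookup z (lookup q i)       ∎)
      in p≢q (Pointwise-≡⇒≡ (ext pᵢ≡qᵢ))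
      where open ≡-Reasoning

  length-transversals : length transversals ≡ 24 * length (solutions z targets)
  length-transversals = begin
    length transversals
      ≡⟨ length-concatMap reorderedSolutions reorderings ⟩
    sum (mapₗ (length ∘ reorderedSolutions) reorderings)
      ≡⟨ cong sum (List.map-cong (λ p → length-map (reorder p) (solutions z targets)) reorderings) ⟩
    sum (mapₗ (λ _ → length (solutions z targets)) reorderings)
      ≡⟨ sum-map-const (length (solutions z targets)) reorderings ⟩
    24 * length (solutions z targets) ∎
    where open ≡-Reasoning

  length-solutions-targets : Proper z → Distinct z →
                             length (solutions z targets) ≡ fibreSize z * b2n (does (λsum λf z ≟ᵇ false))
  length-solutions-targets z₂ z! = begin
    length (solutions z targets)
      ≡⟨ length-solutions z z₂ targets ⟩
    fibreSize z * indicator (supportOf z) targets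
      ≡⟨ cong (λ s → fibreSize z * indicator s targets) (distinctRows⇒evenWeight z z₂ z!) ⟩
    fibreSize z * b2n (does (xorSum targets ≟ᵇ false))
      ≡⟨ cong (λ b → fibreSize z * b2n (does (b ≟ᵇ false))) (xorSum-targets λf z) ⟩
    fibreSize z * b2n (does (λsum λf z ≟ᵇ false)) ∎
    where open ≡-Reasoning

fibreSize-evenWeight : ∀ n (w : Vec (Vec Bool (suc n)) 4) → supportOf w ≡ evenWeight →
                       fibreSize w ≡ 2 * 4 ^ (n ∸ 1)
fibreSize-evenWeight zero    w ()
fibreSize-evenWeight (suc n) w e = *-cancelʳ-≡ (fibreSize w) (2 * 4 ^ n) 8
  (trans (cong (λ s → fibreSize w * size s) (sym e)) (trans (fibreSize-size w) (sym (arithmetic (4 ^ n)))))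
  where
  arithmetic : ∀ x → 2 * x * 8 ≡ 4 * (4 * x)
  arithmetic = +-*-Solver.solve 1 (λ x → con 2 :* x :* con 8 := con 4 :* (con 4 :* x)) refl
    where open +-*-Solver

lemma8 : (n : ℕ) (λf : Vec Bool n → Bool) (z : Vec (Vec Bool (suc n)) 4) →
    Brindled z →
    (λsum λf z ≡ true → ¬ (∃ λ α → Good λf z α)) ×
    (λsum λf z ≡ false → HasExactly (Good λf z) (24 * (2 * 4 ^ (n ∸ 1))))
lemma8 n λf z ((z-proper , z-even) , z!) = noTransversal , countTransversals
  where
  K = fibreSize z

  count : ∀ {b} → λsum λf z ≡ b → length (transversals λf z) ≡ 24 * (K * b2n (does (b ≟ᵇ false)))
  count refl = trans (length-transversals λf z) (cong (24 *_) (length-solutions-targets λf z z-proper z!))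

  noTransversal : λsum λf z ≡ true → ¬ (∃ λ α → Good λf z α)
  noTransversal odd (x , good) =
    ∈⇒length≢0 (good⇒∈transversals λf z z-even x good) (trans (count odd) (cong (24 *_) (*-zeroʳ K)))

  countTransversals : λsum λf z ≡ false → HasExactly (Good λf z) (24 * (2 * 4 ^ (n ∸ 1)))
  countTransversals even =
    transversals λf z ,
    transversals⁺ λf z z! ,
    (λ x → mk⇔ (∈transversals⇒good λf z z-even x) (good⇒∈transversals λf z z-even x)) ,
    trans (count even)
          (cong (24 *_) (trans (*-identityʳ K) (fibreSize-evenWeight n z (distinctRows⇒evenWeight z z-proper z!))))
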